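{- Let $a,b,n$ be positive integers with $n\geq a+b$. Let $A$ be an $a$-subset of $[n]$, let $B$ be the $b$-partner of $A$, and let $A'$ be the $a$-partner of $B$. Then $(A',B)$ is maximal. Moreover, if $A'\neq A$, then $A\prec A'$ and $A\neq A'$.
   Context: Lexicographic order: for finite sets $A,B$ of positive integers, $A\prec B$ if either $A\supseteq B$ or $\min(A\setminus B)<\min(B\setminus A)$. For a $k$-subset $R$ of $[n]$, $\mathcal{L}(R,k)=\{F\in\binom{[n]}{k}:F\prec R\}$. $H$ is the partner of a nonempty set $F\subseteq[n]$ if there is $q$ with $F\cap H=\{q\}$ and $F\cup H=[q]$. For $F\subseteq[n]$ with $|F|=f$ and $k\le n-f$, let $H$ be the partner of $F$ and $h=|H|$; the $k$-partner $K$ of $F$ is: $K=H$ if $k=h$; $K=H\cup\{n-k+h+1,\dots,n\}$ if $k>h$; and if $k<h$, $K$ is the lexicographically last $k$-subset of $[n]$ with $K\prec H$. A cross-intersecting pair $(\mathcal{F},\mathcal{G})$ of uniform families is maximal if it cannot be enlarged (keeping uniformities) while remaining cross-intersecting; for sets $F,G$, $(F,G)$ is maximal if $\mathcal{L}(F,|F|)$ and $\mathcal{L}(G,|G|)$ are cross-intersecting and form a maximal pair. -}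

module Defs where

-- Conventions: a subset of [n] = {1,…,n} is a `Subset n` (Data.Fin.Subset);
-- the element `i : Fin n` represents the integer toℕ i + 1.  The order of
-- integers is thus the order of `toℕ`.

open import Data.Nat using (ℕ; _+_; _∸_; _≤_; _<_; _≤?_)
open import Data.Fin using (Fin; toℕ)
open import Data.Fin.Subset using (Subset; _∈_; _∉_; _⊆_; _∩_; _∪_; ⁅_⁆; ∣_∣; Nonempty; inside; outside)
open import Data.Vec using (tabulate)
open import Data.Product using (Σ; ∃; _×_)
open import Data.Sum using (_⊎_)
open import Relation.Binary.PropositionalEquality using (_≡_)
open import Relation.Nullary.Decidable using (⌊_⌋)
open import Level using (suc; zero)

-- Lexicographic order:  A ≺ B  iff  A ⊇ B  or  min(A∖B) < min(B∖A).
-- The second disjunct: there is i with i = min(A∖B) (i ∈ A, i ∉ B, and every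
-- j < i in A is in B) and every element of B∖A is larger than i
-- (covers also the case where B∖A is empty).
_≺_ : ∀ {n} → Subset n → Subset n → Set
_≺_ {n} A B =
  B ⊆ A ⊎
  Σ (Fin n) λ i → i ∈ A × i ∉ B
    × (∀ (j : Fin n) → toℕ j < toℕ i → j ∈ A → j ∈ B)
    × (∀ (j : Fin n) → toℕ j ≤ toℕ i → j ∈ B → j ∈ A)

infix 4 _≺_

Family : ℕ → Set₁
Family n = Subset n → Set

𝓛 : ∀ {n} → Subset n → ℕ → Family n
𝓛 R k F = ∣ F ∣ ≡ k × F ≺ R

seg : ∀ {n} → Fin n → Subset n
seg q = tabulate λ j → ⌊ toℕ j ≤? toℕ q ⌋

topSeg : (n m : ℕ) → Subset n
topSeg n m = tabulate λ j → ⌊ n ∸ m ≤? toℕ j ⌋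

IsPartner : ∀ {n} → Subset n → Subset n → Set
IsPartner {n} F H = Nonempty F × Σ (Fin n) λ q → (F ∩ H ≡ ⁅ q ⁆) × (F ∪ H ≡ seg q)

IsLexLastBelow : ∀ {n} → ℕ → Subset n → Subset n → Set
IsLexLastBelow k H K =
  ∣ K ∣ ≡ k × K ≺ H × (∀ K' → ∣ K' ∣ ≡ k → K' ≺ H → K' ≺ K)

IsKPartner : (n k : ℕ) → Subset n → Subset n → Set
IsKPartner n k F K =
  k + ∣ F ∣ ≤ n ×
  Σ (Subset n) λ H → IsPartner F H ×
    ( (k ≡ ∣ H ∣ × K ≡ H)
    ⊎ (∣ H ∣ < k × K ≡ H ∪ topSeg n (k ∸ ∣ H ∣))
    ⊎ (k < ∣ H ∣ × IsLexLastBelow k H K))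

Uniform : ∀ {n} → ℕ → Family n → Set
Uniform k 𝓕 = ∀ F → 𝓕 F → ∣ F ∣ ≡ k

CrossIntersecting : ∀ {n} → Family n → Family n → Set
CrossIntersecting 𝓕 𝓖 = ∀ F G → 𝓕 F → 𝓖 G → Nonempty (F ∩ G)

_⊆ᶠ_ : ∀ {n} → Family n → Family n → Set
𝓕 ⊆ᶠ 𝓕' = ∀ F → 𝓕 F → 𝓕' F

MaximalPair : ∀ {n} → ℕ → ℕ → Family n → Family n → Set₁
MaximalPair {n} k l 𝓕 𝓖 =
  Uniform k 𝓕 × Uniform l 𝓖 × CrossIntersecting 𝓕 𝓖 ×
  (∀ (𝓕' 𝓖' : Family n) → Uniform k 𝓕' → Uniform l 𝓖' →
     𝓕 ⊆ᶠ 𝓕' → 𝓖 ⊆ᶠ 𝓖' → CrossIntersecting 𝓕' 𝓖' →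
     (𝓕' ⊆ᶠ 𝓕) × (𝓖' ⊆ᶠ 𝓖))

MaximalSets : ∀ {n} → Subset n → Subset n → Set₁
MaximalSets F G = MaximalPair ∣ F ∣ ∣ G ∣ (𝓛 F ∣ F ∣) (𝓛 G ∣ G ∣)

{-# OPTIONS --safe #-}
module Submission where

-- Read a subset of [n] as the boolean vector of its indicator, starting at 1.
-- Then A ≺ B is lexicographic order with `inside` before `outside`, and a set
-- F and its partner H split [q−1] between them and share q.  Any X ≺ F and
-- Y ≺ H meet: at the first position where X departs from F or Y from H, the
-- departing set gains an element outside its bound, which then lies in the
-- other bound and is kept by the other set; if nobody departs before q, both
-- contain q.  Conversely, if Y does not precede H, the same walk builds an
-- |F|-set X ≺ F avoiding Y.  Hence the k-partner K of F is the ≺-last k-set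
-- meeting all of 𝓛(F,|F|): for K = H this is the dichotomy, for K = H ∪ T
-- with T a top segment, T lies above q and a k-set preceding H precedes
-- H ∪ T as well, and the third case is the definition.  Applied to
-- A → B → A′ this shows that each of 𝓛(A′,a) and 𝓛(B,b) consists of all
-- sets of its size meeting the other, which is maximality, and that A ≺ A′.

open import Defs
open import Data.Fin using (Fin; toℕ; zero; suc)
open import Data.Fin.Subset
  using (Subset; ∣_∣; _∈_; _∩_; _∪_; ⁅_⁆; ⊥; ⊤; Nonempty; Empty; inside; outside)
open import Data.Fin.Subset.Properties
  using (drop-there; drop-∷-⊆; drop-∷-Empty; s⊆s; ⊆-refl; ∉⊥; ∣⊥∣≡0; ∣p∣≤n; ∣⊤∣≡n; ∣p∣≡n⇒p≡⊤;
         Empty-unique; ∩-comm; x∈p∩q⁻; p⊆p∪q; q⊆p∪q)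
open import Data.Nat using (ℕ; zero; suc; _+_; _∸_; _≤_; _<_; z≤n; s≤s; s≤s⁻¹; _≤?_)
open import Data.Nat.Properties
open import Data.Product using (∃; _×_; _,_; proj₁; proj₂)
open import Data.Sum using (_⊎_; inj₁; inj₂)
import Data.Sum as Sum
open import Data.Vec using ([]; _∷_; tabulate; here; there)
open import Data.Vec.Properties
  using (∷-injectiveʳ; tabulate-cong; tabulate∘lookup; lookup-replicate)
open import Function using (_∘_; _⇔_; mk⇔)
open import Relation.Nullary using (Dec; yes; no; contradiction)
open import Relation.Nullary.Decidable using (isYes; isYes≗does; does-⇔; dec-true; dec-false)
open import Relation.Binary.PropositionalEquality
  using (_≡_; _≢_; refl; sym; trans; cong; cong₂; subst; module ≡-Reasoning)

m+1+n≤1+o⇒m+n≤o : ∀ m n {o} → m + suc n ≤ suc o → m + n ≤ o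
m+1+n≤1+o⇒m+n≤o m n {o} le = s≤s⁻¹ (subst (_≤ suc o) (+-suc m n) le)

isYes-⇔ : ∀ {A B : Set} → A ⇔ B → (a? : Dec A) (b? : Dec B) → isYes a? ≡ isYes b?
isYes-⇔ A⇔B a? b? = trans (isYes≗does a?) (trans (does-⇔ A⇔B a? b?) (sym (isYes≗does b?)))

Disjoint : ∀ {m} → Subset m → Subset m → Set
Disjoint p q = Empty (p ∩ q)

∩-nonempty-swap : ∀ {m} {p q : Subset m} → Nonempty (p ∩ q) → Nonempty (q ∩ p)
∩-nonempty-swap {p = p} {q} = subst Nonempty (∩-comm p q)

∷-Nonempty : ∀ {m s} {p : Subset m} → Nonempty p → Nonempty (s ∷ p)
∷-Nonempty (i , i∈) = suc i , there i∈

outside∷-Empty : ∀ {m} {p : Subset m} → Empty p → Empty (outside ∷ p)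
outside∷-Empty p=∅ (suc i , there i∈) = p=∅ (i , i∈)

⊥-disjoint : ∀ {m} (q : Subset m) → Disjoint ⊥ q
⊥-disjoint q (i , i∈) = ∉⊥ (proj₁ (x∈p∩q⁻ ⊥ q i∈))

∪≡⊥⁻ : ∀ {m} {p q : Subset m} → p ∪ q ≡ ⊥ → p ≡ ⊥ × q ≡ ⊥
∪≡⊥⁻ {p = p} {q} p∪q≡⊥ =
  Empty-unique (λ (i , i∈) → ∉⊥ (subst (i ∈_) p∪q≡⊥ (p⊆p∪q q i∈))) ,
  Empty-unique (λ (i , i∈) → ∉⊥ (subst (i ∈_) p∪q≡⊥ (q⊆p∪q p q i∈)))

∣∪∣-disjoint : ∀ {m} (p q : Subset m) → Disjoint p q → ∣ p ∪ q ∣ ≡ ∣ p ∣ + ∣ q ∣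
∣∪∣-disjoint [] [] _ = refl
∣∪∣-disjoint (inside ∷ p) (inside ∷ q) p∩q=∅ = contradiction (zero , here) p∩q=∅
∣∪∣-disjoint (inside ∷ p) (outside ∷ q) p∩q=∅ = cong suc (∣∪∣-disjoint p q (drop-∷-Empty p∩q=∅))
∣∪∣-disjoint (outside ∷ p) (inside ∷ q) p∩q=∅ =
  trans (cong suc (∣∪∣-disjoint p q (drop-∷-Empty p∩q=∅))) (sym (+-suc ∣ p ∣ ∣ q ∣))
∣∪∣-disjoint (outside ∷ p) (outside ∷ q) p∩q=∅ = ∣∪∣-disjoint p q (drop-∷-Empty p∩q=∅)

disjoint-of-size : ∀ {m} (q : Subset m) k → k + ∣ q ∣ ≤ m → ∃ λ p → ∣ p ∣ ≡ k × Disjoint p q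
disjoint-of-size {m} q zero _ = ⊥ , ∣⊥∣≡0 m , ⊥-disjoint q
disjoint-of-size (inside ∷ q) (suc k) k+∣q∣≤m
  with p , ∣p∣≡k , p∩q=∅ ← disjoint-of-size q (suc k)
         (m+1+n≤1+o⇒m+n≤o (suc k) ∣ q ∣ k+∣q∣≤m)
  = outside ∷ p , ∣p∣≡k , outside∷-Empty p∩q=∅
disjoint-of-size (outside ∷ q) (suc k) k+∣q∣≤m
  with p , ∣p∣≡k , p∩q=∅ ← disjoint-of-size q k (s≤s⁻¹ k+∣q∣≤m)
  = inside ∷ p , cong suc ∣p∣≡k , outside∷-Empty p∩q=∅

data _≺ʳ_ : ∀ {m} → Subset m → Subset m → Set where
  done  : [] ≺ʳ []
  first : ∀ {m} {p q : Subset m} → (inside ∷ p) ≺ʳ (outside ∷ q)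
  next  : ∀ {m s} {p q : Subset m} → p ≺ʳ q → (s ∷ p) ≺ʳ (s ∷ q)

infix 4 _≺ʳ_

≺ʳ-refl : ∀ {m} (p : Subset m) → p ≺ʳ p
≺ʳ-refl [] = done
≺ʳ-refl (s ∷ p) = next (≺ʳ-refl p)

≺ʳ-trans : ∀ {m} {p q r : Subset m} → p ≺ʳ q → q ≺ʳ r → p ≺ʳ r
≺ʳ-trans done done = done
≺ʳ-trans first (next _) = first
≺ʳ-trans (next _) first = first
≺ʳ-trans (next p≺q) (next q≺r) = next (≺ʳ-trans p≺q q≺r)

≺ʳ-⊥ : ∀ {m} (p : Subset m) → p ≺ʳ ⊥
≺ʳ-⊥ [] = done
≺ʳ-⊥ (inside ∷ p) = first
≺ʳ-⊥ (outside ∷ p) = next (≺ʳ-⊥ p)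

⊤-≺ʳ : ∀ {m} (q : Subset m) → ⊤ ≺ʳ q
⊤-≺ʳ [] = done
⊤-≺ʳ (inside ∷ q) = next (⊤-≺ʳ q)
⊤-≺ʳ (outside ∷ q) = first

∪-≺ʳ : ∀ {m} (p q : Subset m) → p ∪ q ≺ʳ p
∪-≺ʳ [] [] = done
∪-≺ʳ (inside ∷ p) (t ∷ q) = next (∪-≺ʳ p q)
∪-≺ʳ (outside ∷ p) (inside ∷ q) = first
∪-≺ʳ (outside ∷ p) (outside ∷ q) = next (∪-≺ʳ p q)

≺-∷ : ∀ {m s} {p q : Subset m} → p ≺ q → s ∷ p ≺ s ∷ q
≺-∷ (inj₁ q⊆p) = inj₁ (s⊆s q⊆p)
≺-∷ (inj₂ (i , i∈p , i∉q , p⊆q-below , q⊆p-below)) =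
  inj₂ (suc i , there i∈p , i∉q ∘ drop-there ,
        (λ { zero _ here → here ; (suc j) j<i (there j∈) → there (p⊆q-below j (s≤s⁻¹ j<i) j∈) }) ,
        (λ { zero _ here → here ; (suc j) j≤i (there j∈) → there (q⊆p-below j (s≤s⁻¹ j≤i) j∈) }))

≺-∷⁻ : ∀ {m s} {p q : Subset m} → s ∷ p ≺ s ∷ q → p ≺ q
≺-∷⁻ (inj₁ q⊆p) = inj₁ (drop-∷-⊆ q⊆p)
≺-∷⁻ (inj₂ (zero , here , 0∉q , _)) = contradiction here 0∉q
≺-∷⁻ (inj₂ (suc i , i∈p , i∉q , p⊆q-below , q⊆p-below)) =
  inj₂ (i , drop-there i∈p , i∉q ∘ there ,
        (λ j j<i j∈ → drop-there (p⊆q-below (suc j) (s≤s j<i) (there j∈))) ,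
        (λ j j≤i j∈ → drop-there (q⊆p-below (suc j) (s≤s j≤i) (there j∈))))

≺ʳ⇒≺ : ∀ {m} {p q : Subset m} → p ≺ʳ q → p ≺ q
≺ʳ⇒≺ done = inj₁ λ ()
≺ʳ⇒≺ first = inj₂ (zero , here , (λ ()) , (λ _ ()) , λ { zero _ () ; (suc _) () _ })
≺ʳ⇒≺ (next p≺q) = ≺-∷ (≺ʳ⇒≺ p≺q)

≺⇒≺ʳ : ∀ {m} (p q : Subset m) → p ≺ q → p ≺ʳ q
≺⇒≺ʳ [] [] _ = done
≺⇒≺ʳ (inside ∷ p) (outside ∷ q) _ = first
≺⇒≺ʳ (outside ∷ p) (inside ∷ q) (inj₁ q⊆p) = contradiction (q⊆p here) λ ()
≺⇒≺ʳ (outside ∷ p) (inside ∷ q) (inj₂ (zero , () , _))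
≺⇒≺ʳ (outside ∷ p) (inside ∷ q) (inj₂ (suc _ , _ , _ , _ , q⊆p-below)) =
  contradiction (q⊆p-below zero z≤n here) λ ()
≺⇒≺ʳ (inside ∷ p) (inside ∷ q) p≺q = next (≺⇒≺ʳ p q (≺-∷⁻ p≺q))
≺⇒≺ʳ (outside ∷ p) (outside ∷ q) p≺q = next (≺⇒≺ʳ p q (≺-∷⁻ p≺q))

≺-refl : ∀ {m} (p : Subset m) → p ≺ p
≺-refl p = inj₁ ⊆-refl

≺-trans : ∀ {m} {p q r : Subset m} → p ≺ q → q ≺ r → p ≺ r
≺-trans {p = p} {q} {r} p≺q q≺r = ≺ʳ⇒≺ (≺ʳ-trans (≺⇒≺ʳ p q p≺q) (≺⇒≺ʳ q r q≺r))

data Partners : ∀ {m} → Subset m → Subset m → Set where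
  last  : ∀ {m} → Partners {suc m} ⁅ zero ⁆ ⁅ zero ⁆
  left  : ∀ {m} {p q : Subset m} → Partners p q → Partners (inside ∷ p) (outside ∷ q)
  right : ∀ {m} {p q : Subset m} → Partners p q → Partners (outside ∷ p) (inside ∷ q)

seg-zero : ∀ {m} → seg {suc m} zero ≡ ⁅ zero ⁆
seg-zero {m} = cong (inside ∷_)
  (trans (tabulate-cong λ j → sym (lookup-replicate j outside)) (tabulate∘lookup ⊥))

seg-suc : ∀ {m} (i : Fin m) → seg (suc i) ≡ inside ∷ seg i
seg-suc i = cong (inside ∷_) (tabulate-cong λ j → isYes-⇔ (mk⇔ s≤s⁻¹ s≤s) _ _)

∩∪⇒Partners : ∀ {m} (p q : Subset m) (i : Fin m) → p ∩ q ≡ ⁅ i ⁆ → p ∪ q ≡ seg i → Partners p q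
∩∪⇒Partners (inside ∷ p) (inside ∷ q) zero _ p∪q≡seg
  with refl , refl ← ∪≡⊥⁻ (∷-injectiveʳ (trans p∪q≡seg seg-zero)) = last
∩∪⇒Partners (inside ∷ p) (outside ∷ q) zero () _
∩∪⇒Partners (outside ∷ p) (t ∷ q) zero () _
∩∪⇒Partners (inside ∷ p) (inside ∷ q) (suc i) () _
∩∪⇒Partners (outside ∷ p) (outside ∷ q) (suc i) _ ()
∩∪⇒Partners (inside ∷ p) (outside ∷ q) (suc i) p∩q≡ p∪q≡ =
  left (∩∪⇒Partners p q i (∷-injectiveʳ p∩q≡) (∷-injectiveʳ (trans p∪q≡ (seg-suc i))))
∩∪⇒Partners (outside ∷ p) (inside ∷ q) (suc i) p∩q≡ p∪q≡ =
  right (∩∪⇒Partners p q i (∷-injectiveʳ p∩q≡) (∷-injectiveʳ (trans p∪q≡ (seg-suc i))))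

IsPartner⇒Partners : ∀ {m} {p q : Subset m} → IsPartner p q → Partners p q
IsPartner⇒Partners {p = p} {q} (_ , i , p∩q≡ , p∪q≡) = ∩∪⇒Partners p q i p∩q≡ p∪q≡

partners-nonempty : ∀ {m} {p q : Subset m} → Partners p q → 0 < ∣ p ∣ × 0 < ∣ q ∣
partners-nonempty last = s≤s z≤n , s≤s z≤n
partners-nonempty (left pt) = s≤s z≤n , proj₂ (partners-nonempty pt)
partners-nonempty (right pt) = proj₁ (partners-nonempty pt) , s≤s z≤n

partners-meet : ∀ {m} {p q x y : Subset m} → Partners p q → x ≺ʳ p → y ≺ʳ q → Nonempty (x ∩ y)
partners-meet last (next _) (next _) = zero , here
partners-meet (left _) (next _) first = zero , here
partners-meet (left pt) (next x≺p) (next y≺q) = ∷-Nonempty (partners-meet pt x≺p y≺q)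
partners-meet (right _) first (next _) = zero , here
partners-meet (right pt) (next x≺p) (next y≺q) = ∷-Nonempty (partners-meet pt x≺p y≺q)

partners-≺ʳ-or-missed : ∀ {m} {p q : Subset m} (y : Subset m) → Partners p q → ∣ y ∣ + ∣ p ∣ ≤ m →
  y ≺ʳ q ⊎ ∃ λ x → ∣ x ∣ ≡ ∣ p ∣ × x ≺ʳ p × Disjoint x y
partners-≺ʳ-or-missed (inside ∷ y) last _ = inj₁ (next (≺ʳ-⊥ y))
partners-≺ʳ-or-missed (outside ∷ y) last _ =
  inj₂ (⁅ zero ⁆ , refl , ≺ʳ-refl _ , outside∷-Empty (⊥-disjoint y))
partners-≺ʳ-or-missed (inside ∷ y) (left pt) _ = inj₁ first
partners-≺ʳ-or-missed (outside ∷ y) (left {p = p} pt) y+p≤m =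
  Sum.map next
    (λ (x , ∣x∣ , x≺p , x∩y=∅) → inside ∷ x , cong suc ∣x∣ , next x≺p , outside∷-Empty x∩y=∅)
    (partners-≺ʳ-or-missed y pt (m+1+n≤1+o⇒m+n≤o ∣ y ∣ ∣ p ∣ y+p≤m))
partners-≺ʳ-or-missed (inside ∷ y) (right pt) y+p≤m =
  Sum.map next (λ (x , ∣x∣ , x≺p , x∩y=∅) → outside ∷ x , ∣x∣ , next x≺p , outside∷-Empty x∩y=∅)
    (partners-≺ʳ-or-missed y pt (s≤s⁻¹ y+p≤m))
-- q starts with `inside`, so y ⊀ q; put 1 into x (p is nonempty) and fill
-- up the rest away from y.
partners-≺ʳ-or-missed {suc m} (outside ∷ y) (right {p = p} pt) y+p≤m
  with ∣ p ∣ | proj₁ (partners-nonempty pt)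
... | suc k | _
  with z , ∣z∣≡k , z∩y=∅ ← disjoint-of-size y k
         (subst (_≤ m) (+-comm ∣ y ∣ k) (m+1+n≤1+o⇒m+n≤o ∣ y ∣ k y+p≤m))
  = inj₂ (inside ∷ z , cong suc ∣z∣≡k , first , outside∷-Empty z∩y=∅)

topSeg-∷ : ∀ m k → topSeg (suc m) k ≡ isYes (suc m ≤? k) ∷ topSeg m k
topSeg-∷ m k = cong₂ _∷_
  (isYes-⇔ (mk⇔ (m∸n≡0⇒m≤n ∘ n≤0⇒n≡0) (≤-reflexive ∘ m≤n⇒m∸n≡0)) _ _)
  (tabulate-cong λ j → isYes-⇔ (suc∸≤suc⇔ m k (toℕ j)) _ _)
  where
  suc∸≤suc⇔ : ∀ m k j → suc m ∸ k ≤ suc j ⇔ m ∸ k ≤ j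
  suc∸≤suc⇔ m zero j = mk⇔ s≤s⁻¹ s≤s
  suc∸≤suc⇔ zero (suc k) j = mk⇔ (λ _ → z≤n) (λ _ → subst (_≤ suc j) (sym (0∸n≡0 k)) z≤n)
  suc∸≤suc⇔ (suc m) (suc k) j = suc∸≤suc⇔ m k j

topSeg-outside : ∀ {m k} → k ≤ m → topSeg (suc m) k ≡ outside ∷ topSeg m k
topSeg-outside {m} {k} k≤m = trans (topSeg-∷ m k)
  (cong (_∷ topSeg m k) (trans (isYes≗does (suc m ≤? k)) (dec-false (suc m ≤? k) (<⇒≱ (s≤s k≤m)))))

topSeg-⊤ : ∀ {m k} → m ≤ k → topSeg m k ≡ ⊤
topSeg-⊤ {zero} _ = refl
topSeg-⊤ {suc m} {k} m<k = trans (topSeg-∷ m k)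
  (cong₂ _∷_ (trans (isYes≗does (suc m ≤? k)) (dec-true (suc m ≤? k) m<k)) (topSeg-⊤ (<⇒≤ m<k)))

∣topSeg∣ : ∀ {m k} → k ≤ m → ∣ topSeg m k ∣ ≡ k
∣topSeg∣ {zero} z≤n = refl
∣topSeg∣ {suc m} k≤1+m with m≤n⇒m<n∨m≡n k≤1+m
... | inj₁ (s≤s k≤m) = trans (cong ∣_∣ (topSeg-outside k≤m)) (∣topSeg∣ k≤m)
... | inj₂ refl = trans (cong ∣_∣ (topSeg-⊤ {suc m} ≤-refl)) (∣⊤∣≡n (suc m))

partners-room : ∀ {m k} {p q : Subset m} → Partners p q → ∣ p ∣ + ∣ q ∣ + k ≤ suc m → k < m
partners-room {k = k} pt p+q+k≤1+m with 0<p , 0<q ← partners-nonempty pt =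
  s≤s⁻¹ (≤-trans (+-monoˡ-≤ k (+-mono-≤ 0<p 0<q)) p+q+k≤1+m)

disjoint-topSeg-∷ : ∀ {m k s} {q : Subset m} → k ≤ m → Disjoint q (topSeg m k) →
  Disjoint (s ∷ q) (topSeg (suc m) k)
disjoint-topSeg-∷ {s = inside} k≤m q∩T=∅ =
  subst (Disjoint _) (sym (topSeg-outside k≤m)) (outside∷-Empty q∩T=∅)
disjoint-topSeg-∷ {s = outside} k≤m q∩T=∅ =
  subst (Disjoint _) (sym (topSeg-outside k≤m)) (outside∷-Empty q∩T=∅)

partners-disjoint-topSeg : ∀ {m k} {p q : Subset m} → Partners p q → ∣ p ∣ + ∣ q ∣ + k ≤ suc m →
  Disjoint q (topSeg m k)
partners-disjoint-topSeg pt@last room =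
  disjoint-topSeg-∷ (s≤s⁻¹ (partners-room pt room)) (⊥-disjoint _)
partners-disjoint-topSeg pt@(left pt′) room =
  disjoint-topSeg-∷ (s≤s⁻¹ (partners-room pt room)) (partners-disjoint-topSeg pt′ (s≤s⁻¹ room))
partners-disjoint-topSeg {k = k} pt@(right {m} {p} {q} pt′) room =
  disjoint-topSeg-∷ (s≤s⁻¹ (partners-room pt room))
    (partners-disjoint-topSeg pt′
      (s≤s⁻¹ (subst (λ c → c + k ≤ suc (suc m)) (+-suc ∣ p ∣ ∣ q ∣) room)))

≺ʳ-∪-topSeg : ∀ {m k} {y h : Subset m} → y ≺ʳ h → ∣ y ∣ ≡ ∣ h ∣ + k → Disjoint h (topSeg m k) →
  y ≺ʳ h ∪ topSeg m k
≺ʳ-∪-topSeg {zero} done _ _ = done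
≺ʳ-∪-topSeg {suc m} {k} {y} {h} y≺h ∣y∣≡ h∩T=∅ with k ≤? m
... | no k≰m = subst (_≺ʳ _) (sym (∣p∣≡n⇒p≡⊤ ∣y∣≡1+m)) (⊤-≺ʳ _)
  where
  ∣y∣≡1+m : ∣ y ∣ ≡ suc m
  ∣y∣≡1+m = ≤-antisym (∣p∣≤n y)
    (≤-trans (≰⇒> k≰m) (subst (k ≤_) (sym ∣y∣≡) (m≤n+m k ∣ h ∣)))
... | yes k≤m rewrite topSeg-outside k≤m = step y≺h ∣y∣≡ h∩T=∅
  where
  step : ∀ {y h} → y ≺ʳ h → ∣ y ∣ ≡ ∣ h ∣ + k → Disjoint h (outside ∷ topSeg m k) →
    y ≺ʳ h ∪ (outside ∷ topSeg m k)
  step first _ _ = first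
  step (next {s = inside} y≺h) ∣y∣≡ h∩T=∅ =
    next (≺ʳ-∪-topSeg y≺h (suc-injective ∣y∣≡) (drop-∷-Empty h∩T=∅))
  step (next {s = outside} y≺h) ∣y∣≡ h∩T=∅ =
    next (≺ʳ-∪-topSeg y≺h ∣y∣≡ (drop-∷-Empty h∩T=∅))

KPartnerShape : (n k : ℕ) → Subset n → Subset n → Set
KPartnerShape n k H K =
    (k ≡ ∣ H ∣ × K ≡ H)
  ⊎ (∣ H ∣ < k × K ≡ H ∪ topSeg n (k ∸ ∣ H ∣))
  ⊎ (k < ∣ H ∣ × IsLexLastBelow k H K)

kPartner-≺ʳ-partner : ∀ {n k} {H K : Subset n} → KPartnerShape n k H K → K ≺ʳ H
kPartner-≺ʳ-partner {H = H} (inj₁ (_ , refl)) = ≺ʳ-refl H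
kPartner-≺ʳ-partner {H = H} (inj₂ (inj₁ (_ , refl))) = ∪-≺ʳ H _
kPartner-≺ʳ-partner {H = H} {K} (inj₂ (inj₂ (_ , _ , K≺H , _))) = ≺⇒≺ʳ K H K≺H

partner-disjoint-topSeg : ∀ {n k} {F H : Subset n} → Partners F H → k + ∣ F ∣ ≤ n → ∣ H ∣ < k →
  Disjoint H (topSeg n (k ∸ ∣ H ∣))
partner-disjoint-topSeg {n} {k} {F} {H} pt k+F≤n H<k = partners-disjoint-topSeg pt (begin
  ∣ F ∣ + ∣ H ∣ + (k ∸ ∣ H ∣)   ≡⟨ +-assoc ∣ F ∣ ∣ H ∣ _ ⟩
  ∣ F ∣ + (∣ H ∣ + (k ∸ ∣ H ∣)) ≡⟨ cong (∣ F ∣ +_) (m+[n∸m]≡n (<⇒≤ H<k)) ⟩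
  ∣ F ∣ + k                     ≡⟨ +-comm ∣ F ∣ k ⟩
  k + ∣ F ∣                     ≤⟨ k+F≤n ⟩
  n                             ≤⟨ n≤1+n n ⟩
  suc n                         ∎)
  where open ≤-Reasoning

kPartner-card : ∀ {n k} {F K : Subset n} → IsKPartner n k F K → ∣ K ∣ ≡ k
kPartner-card (_ , _ , _ , inj₁ (k≡∣H∣ , refl)) = sym k≡∣H∣
kPartner-card {n} {k} {F} (k+F≤n , H , F-H , inj₂ (inj₁ (H<k , refl))) = begin
  ∣ H ∪ topSeg n (k ∸ ∣ H ∣) ∣     ≡⟨ ∣∪∣-disjoint H _ H∩T=∅ ⟩
  ∣ H ∣ + ∣ topSeg n (k ∸ ∣ H ∣) ∣ ≡⟨ cong (∣ H ∣ +_) (∣topSeg∣ k∸H≤n) ⟩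
  ∣ H ∣ + (k ∸ ∣ H ∣)              ≡⟨ m+[n∸m]≡n (<⇒≤ H<k) ⟩
  k                                ∎
  where
  open ≡-Reasoning
  H∩T=∅ = partner-disjoint-topSeg (IsPartner⇒Partners F-H) k+F≤n H<k
  k∸H≤n = ≤-trans (m∸n≤m k ∣ H ∣) (≤-trans (m≤m+n k ∣ F ∣) k+F≤n)
kPartner-card (_ , _ , _ , inj₂ (inj₂ (_ , ∣K∣≡k , _))) = ∣K∣≡k

kPartner-cross : ∀ {n k} {F K : Subset n} → IsKPartner n k F K → CrossIntersecting (_≺ F) (_≺ K)
kPartner-cross {F = F} {K} (_ , H , F-H , shape) X Y X≺F Y≺K =
  partners-meet (IsPartner⇒Partners F-H) (≺⇒≺ʳ X F X≺F)
    (≺ʳ-trans (≺⇒≺ʳ Y K Y≺K) (kPartner-≺ʳ-partner shape))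

kPartner-last : ∀ {n k} {F K Y : Subset n} → IsKPartner n k F K → ∣ Y ∣ ≡ k →
  (∀ X → 𝓛 F ∣ F ∣ X → Nonempty (X ∩ Y)) → Y ≺ K
kPartner-last {n} {k} {F} {K} {Y} (k+F≤n , H , F-H , shape) ∣Y∣≡k meets = from-shape shape
  where
  pt : Partners F H
  pt = IsPartner⇒Partners F-H

  Y≺H : Y ≺ʳ H
  Y≺H with partners-≺ʳ-or-missed Y pt (subst (λ c → c + ∣ F ∣ ≤ n) (sym ∣Y∣≡k) k+F≤n)
  ... | inj₁ Y≺H = Y≺H
  ... | inj₂ (X , ∣X∣ , X≺F , X∩Y=∅) = contradiction (meets X (∣X∣ , ≺ʳ⇒≺ X≺F)) X∩Y=∅

  from-shape : KPartnerShape n k H K → Y ≺ K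
  from-shape (inj₁ (_ , K≡H)) = subst (Y ≺_) (sym K≡H) (≺ʳ⇒≺ Y≺H)
  from-shape (inj₂ (inj₁ (H<k , K≡H∪T))) = subst (Y ≺_) (sym K≡H∪T) (≺ʳ⇒≺
    (≺ʳ-∪-topSeg Y≺H (trans ∣Y∣≡k (sym (m+[n∸m]≡n (<⇒≤ H<k))))
      (partner-disjoint-topSeg pt k+F≤n H<k)))
  from-shape (inj₂ (inj₂ (_ , _ , _ , K-last))) = K-last Y ∣Y∣≡k (≺ʳ⇒≺ Y≺H)

saturated⇒MaximalPair : ∀ {n k l} {𝓕 𝓖 : Family n} →
  Uniform k 𝓕 → Uniform l 𝓖 → CrossIntersecting 𝓕 𝓖 →
  (∀ F → ∣ F ∣ ≡ k → (∀ G → 𝓖 G → Nonempty (F ∩ G)) → 𝓕 F) →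
  (∀ G → ∣ G ∣ ≡ l → (∀ F → 𝓕 F → Nonempty (F ∩ G)) → 𝓖 G) →
  MaximalPair k l 𝓕 𝓖
saturated⇒MaximalPair 𝓕-unif 𝓖-unif cross 𝓕-sat 𝓖-sat =
  𝓕-unif , 𝓖-unif , cross , λ 𝓕′ 𝓖′ 𝓕′-unif 𝓖′-unif 𝓕⊆𝓕′ 𝓖⊆𝓖′ cross′ →
    (λ F F∈ → 𝓕-sat F (𝓕′-unif F F∈) (λ G G∈ → cross′ F G F∈ (𝓖⊆𝓖′ G G∈))) ,
    (λ G G∈ → 𝓖-sat G (𝓖′-unif G G∈) (λ F F∈ → cross′ F G (𝓕⊆𝓕′ F F∈) G∈))

fact2p10 : (a b n : ℕ) → 0 < a → 0 < b → a + b ≤ n →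
    (A B A' : Subset n) → ∣ A ∣ ≡ a →
    IsKPartner n b A B → IsKPartner n a B A' →
    MaximalSets A' B × (A' ≢ A → (A ≺ A') × (A ≢ A'))
fact2p10 a b n _ _ _ A B A' ∣A∣≡a A→B B→A' = maximal , λ A'≢A → A≺A' , A'≢A ∘ sym
  where
  A≺A' : A ≺ A'
  A≺A' = kPartner-last B→A' ∣A∣≡a
    λ Y (_ , Y≺B) → ∩-nonempty-swap (kPartner-cross A→B A Y (≺-refl A) Y≺B)

  ∣A∣≡∣A'∣ : ∣ A ∣ ≡ ∣ A' ∣
  ∣A∣≡∣A'∣ = trans ∣A∣≡a (sym (kPartner-card B→A'))

  maximal : MaximalSets A' B
  maximal = saturated⇒MaximalPair (λ _ → proj₁) (λ _ → proj₁)
    (λ X Y (_ , X≺A') (_ , Y≺B) → ∩-nonempty-swap (kPartner-cross B→A' Y X Y≺B X≺A'))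
    (λ X ∣X∣ meets → ∣X∣ , kPartner-last B→A' (trans ∣X∣ (kPartner-card B→A'))
                             (λ Y Y∈ → ∩-nonempty-swap (meets Y Y∈)))
    (λ Y ∣Y∣ meets → ∣Y∣ , kPartner-last A→B (trans ∣Y∣ (kPartner-card A→B))
                             (λ X (∣X∣ , X≺A) → meets X (trans ∣X∣ ∣A∣≡∣A'∣ , ≺-trans X≺A A≺A')))
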